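{- Let $R\in\mathbb N^p$, $C\in\mathbb N^q$, let $\mathbf A,\mathbf A'\in\mathcal M(R,C)$ and let $\mathbf M=\mathbf A'-\mathbf A$. If $\mathbf A'$ can be reached from $\mathbf A$ by a finite sequence of positive switches, then there exists a unique matrix $\mathbf T=(t_{ik})\in\mathcal M_{p-1,q-1}(\mathbb N)$ such that $\mathbf M=\sum_{i=1}^{p-1}\sum_{k=1}^{q-1} t_{ik}\,\mathbf C_{i,i+1,k,k+1}$.
   Context: $\mathcal M(R,C)$ denotes the set of $p\times q$ $(0,1)$-matrices with row sums $R$ and column sums $C$. A checkerboard is a $2\times2$ submatrix on rows $i<j$ and columns $k<l$; positive if equal to $\begin{pmatrix}1&0\\0&1\end{pmatrix}$, negative if equal to $\begin{pmatrix}0&1\\1&0\end{pmatrix}$. A positive switch replaces a negative checkerboard by the positive one. For $i<j$, $k<l$, the switching matrix $\mathbf C_{i,j,k,l}$ is the $p\times q$ matrix with entries $+1$ at positions $(i,k)$ and $(j,l)$, $-1$ at positions $(i,l)$ and $(j,k)$, and $0$ elsewhere. $\mathcal M_{p-1,q-1}(\mathbb N)$ is the set of $(p-1)\times(q-1)$ matrices with non-negative integer entries. -}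

module Defs where

open import Data.Nat using (ℕ; zero; suc)
import Data.Nat as N
open import Data.Integer using (ℤ; _+_; _-_; _*_; +_)
open import Data.Fin using (Fin; zero; suc; inject₁; _<_; _≟_)
open import Data.Bool using (Bool; true; false; if_then_else_; _∧_)
open import Data.Product using (Σ; _×_; ∃-syntax)
open import Data.Sum using (_⊎_)
open import Relation.Binary.PropositionalEquality using (_≡_)
open import Relation.Nullary using (¬_)
open import Relation.Nullary.Decidable using (⌊_⌋)
open import Relation.Binary.Construct.Closure.ReflexiveTransitive using (Star)

BinMat : ℕ → ℕ → Set
BinMat p q = Fin p → Fin q → Bool

ZMat : ℕ → ℕ → Set
ZMat p q = Fin p → Fin q → ℤ

sumℕ : (n : ℕ) → (Fin n → ℕ) → ℕ
sumℕ zero    f = 0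
sumℕ (suc n) f = f zero N.+ sumℕ n (λ i → f (suc i))

sumℤ : (n : ℕ) → (Fin n → ℤ) → ℤ
sumℤ zero    f = + 0
sumℤ (suc n) f = f zero + sumℤ n (λ i → f (suc i))

bℕ : Bool → ℕ
bℕ b = if b then 1 else 0

bℤ : Bool → ℤ
bℤ b = if b then + 1 else + 0

InM : {p q : ℕ} → (Fin p → ℕ) → (Fin q → ℕ) → BinMat p q → Set
InM {p} {q} R C A =
  (∀ x → sumℕ q (λ y → bℕ (A x y)) ≡ R x) ×
  (∀ y → sumℕ p (λ x → bℕ (A x y)) ≡ C y)

PositiveSwitch : {p q : ℕ} → BinMat p q → BinMat p q → Set
PositiveSwitch {p} {q} A B =
  ∃[ i ] ∃[ j ] ∃[ k ] ∃[ l ]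
    (i < j) × (k < l) ×
    (A i k ≡ false) × (A i l ≡ true) × (A j k ≡ true) × (A j l ≡ false) ×
    (B i k ≡ true) × (B i l ≡ false) × (B j k ≡ false) × (B j l ≡ true) ×
    (∀ (x : Fin p) (y : Fin q) →
       ¬ ((x ≡ i ⊎ x ≡ j) × (y ≡ k ⊎ y ≡ l)) → B x y ≡ A x y)

Reachable : {p q : ℕ} → BinMat p q → BinMat p q → Set
Reachable = Star PositiveSwitch

δ : {p q : ℕ} → Fin p → Fin q → Fin p → Fin q → ℤ
δ i k x y = if ⌊ x ≟ i ⌋ ∧ ⌊ y ≟ k ⌋ then + 1 else + 0

switchMat : {p q : ℕ} → Fin p → Fin p → Fin q → Fin q → ZMat p q
switchMat i j k l x y = δ i k x y + δ j l x y - δ i l x y - δ j k x y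

diffMat : {p q : ℕ} → BinMat p q → BinMat p q → ZMat p q
diffMat A′ A x y = bℤ (A′ x y) - bℤ (A x y)

-- Σ_{i<p} Σ_{k<q} t_{ik} C_{i,i+1,k,k+1}, for a (p+1)×(q+1) matrix.
combo : {p q : ℕ} → (Fin p → Fin q → ℕ) → ZMat (suc p) (suc q)
combo {p} {q} T x y =
  sumℤ p (λ i → sumℤ q (λ k →
    (+ T i k) * switchMat (inject₁ i) (suc i) (inject₁ k) (suc k) x y))

-- Write e_i for the i-th unit vector and d_i = e_i − e_{i+1}. Then C_{i,i+1,k,k+1} = d_i ⊗ d_k,
-- so Σ t_{ik} C_{i,i+1,k,k+1} is the backward difference Δ applied to T in both directions.
-- Δ is injective (the first entry of Δ f is f 0, and Δ of the shifted f is recovered from Δ f),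
-- which gives uniqueness. For existence, a single switch C_{i,j,k,l} = (e_i − e_j) ⊗ (e_k − e_l)
-- is Δ ⊗ Δ of the indicator of the rectangle [i,j) × [k,l), a (0,1)-matrix; summing these
-- along the sequence of switches gives T.
module Submission where

open import Defs
open import Data.Nat using (ℕ; suc; zero; z≤n; s≤s⁻¹)
import Data.Nat as ℕ
open import Data.Integer using (ℤ; _+_; _-_; _*_; +_; -_)
open import Data.Integer.Properties
  using ( +-injective; +-identityʳ; +-inverseʳ; *-zeroʳ; *-comm; *-assoc; *-distribʳ-+; pos-+; pos-*
        ; +-0-abelianGroup)
open import Data.Integer.Solver using (module +-*-Solver)
open import Algebra.Properties.AbelianGroup +-0-abelianGroup using (∙-cancelʳ)
open import Data.Fin using (Fin; zero; suc; inject₁; _≟_)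
import Data.Fin as F
open import Data.Fin.Properties using (<⇒≢)
open import Data.Nat.Properties using (<⇒≤)
open import Data.Bool using (true; false; if_then_else_; _∧_)
open import Data.Product using (Σ; _×_; _,_)
open import Data.Sum using (_⊎_; inj₁; inj₂)
open import Function using (_∘_)
open import Relation.Binary.PropositionalEquality
open import Relation.Nullary using (¬_; Dec; yes; no)
open import Relation.Nullary.Decidable using (does; isYes≗does; dec-true; dec-false)
open import Relation.Binary.Construct.Closure.ReflexiveTransitive using (ε; _◅_)

open +-*-Solver
open ≡-Reasoning

sumℤ-cong : ∀ n {f g : Fin n → ℤ} → (∀ i → f i ≡ g i) → sumℤ n f ≡ sumℤ n g
sumℤ-cong zero    f≡g = refl
sumℤ-cong (suc n) f≡g = cong₂ _+_ (f≡g zero) (sumℤ-cong n (f≡g ∘ suc))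

sumℤ-zero : ∀ n {f : Fin n → ℤ} → (∀ i → f i ≡ + 0) → sumℤ n f ≡ + 0
sumℤ-zero zero    f≡0 = refl
sumℤ-zero (suc n) f≡0 = cong₂ _+_ (f≡0 zero) (sumℤ-zero n (f≡0 ∘ suc))

sumℤ-+ : ∀ n (f g : Fin n → ℤ) → sumℤ n (λ i → f i + g i) ≡ sumℤ n f + sumℤ n g
sumℤ-+ zero    f g = refl
sumℤ-+ (suc n) f g = begin
  f zero + g zero + sumℤ n (λ i → f (suc i) + g (suc i))
    ≡⟨ cong (_+_ (f zero + g zero)) (sumℤ-+ n (f ∘ suc) (g ∘ suc)) ⟩
  f zero + g zero + (sumℤ n (f ∘ suc) + sumℤ n (g ∘ suc))
    ≡⟨ solve 4 (λ a b c d → a :+ b :+ (c :+ d) := a :+ c :+ (b :+ d)) refl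
         (f zero) (g zero) (sumℤ n (f ∘ suc)) (sumℤ n (g ∘ suc)) ⟩
  f zero + sumℤ n (f ∘ suc) + (g zero + sumℤ n (g ∘ suc)) ∎

sumℤ-*ˡ : ∀ n c (f : Fin n → ℤ) → sumℤ n (λ i → c * f i) ≡ c * sumℤ n f
sumℤ-*ˡ zero    c f = sym (*-zeroʳ c)
sumℤ-*ˡ (suc n) c f = begin
  c * f zero + sumℤ n (λ i → c * f (suc i)) ≡⟨ cong (_+_ (c * f zero)) (sumℤ-*ˡ n c (f ∘ suc)) ⟩
  c * f zero + c * sumℤ n (f ∘ suc)         ≡⟨ solve 3 (λ c a s → c :* a :+ c :* s := c :* (a :+ s))
                                                 refl c (f zero) (sumℤ n (f ∘ suc)) ⟩
  c * (f zero + sumℤ n (f ∘ suc))           ∎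

-- Defined with does, not ⌊_⌋ as in δ, so that δ₁ (suc i) (suc x) reduces to δ₁ i x.
δ₁ : ∀ {n} → Fin n → Fin n → ℤ
δ₁ i x = if does (x ≟ i) then + 1 else + 0

δ₁-refl : ∀ {n} (i : Fin n) → δ₁ i i ≡ + 1
δ₁-refl i = cong (if_then + 1 else + 0) (dec-true (i ≟ i) refl)

δ₁-≢ : ∀ {n} {i x : Fin n} → ¬ x ≡ i → δ₁ i x ≡ + 0
δ₁-≢ {i = i} {x} x≢i = cong (if_then + 1 else + 0) (dec-false (x ≟ i) x≢i)

δ-factor : ∀ {p q} (i x : Fin p) (k y : Fin q) → δ i k x y ≡ δ₁ i x * δ₁ k y
δ-factor i x k y
  rewrite isYes≗does (x ≟ i) | isYes≗does (y ≟ k) = if∧ (does (x ≟ i)) (does (y ≟ k))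
  where
  if∧ : ∀ b c → (if b ∧ c then + 1 else + 0) ≡ (if b then + 1 else + 0) * (if c then + 1 else + 0)
  if∧ true  true  = refl
  if∧ true  false = refl
  if∧ false c     = refl

switchMat-factor : ∀ {p q} (i j x : Fin p) (k l y : Fin q) →
  switchMat i j k l x y ≡ (δ₁ i x - δ₁ j x) * (δ₁ k y - δ₁ l y)
switchMat-factor i j x k l y = begin
  δ i k x y + δ j l x y - δ i l x y - δ j k x y
    ≡⟨ cong₂ _-_ (cong₂ _-_ (cong₂ _+_ (δ-factor i x k y) (δ-factor j x l y))
                            (δ-factor i x l y)) (δ-factor j x k y) ⟩
  δ₁ i x * δ₁ k y + δ₁ j x * δ₁ l y - δ₁ i x * δ₁ l y - δ₁ j x * δ₁ k y
    ≡⟨ solve 4 (λ a b c d → a :* c :+ b :* d :- a :* d :- b :* c := (a :- b) :* (c :- d))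
         refl (δ₁ i x) (δ₁ j x) (δ₁ k y) (δ₁ l y) ⟩
  (δ₁ i x - δ₁ j x) * (δ₁ k y - δ₁ l y) ∎

-- Backward difference: Δ f y = f y − f (y − 1), with f extended by 0 outside Fin n.
step : ∀ {n} → Fin n → Fin (suc n) → ℤ
step k y = δ₁ (inject₁ k) y - δ₁ (suc k) y

Δ : ∀ {n} → (Fin n → ℤ) → Fin (suc n) → ℤ
Δ {n} f y = sumℤ n (λ k → f k * step k y)

Δ-cong : ∀ {n} {f g : Fin n → ℤ} → (∀ i → f i ≡ g i) → ∀ y → Δ f y ≡ Δ g y
Δ-cong {n} f≡g y = sumℤ-cong n (λ k → cong (_* step k y) (f≡g k))

Δ-zero : ∀ {n} (f : Fin (suc n) → ℤ) → Δ f zero ≡ f zero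
Δ-zero {n} f = begin
  f zero * (+ 1 - + 0) + sumℤ n (λ k → f (suc k) * (+ 0 - + 0))
    ≡⟨ cong (_+_ (f zero * (+ 1 - + 0))) (sumℤ-zero n (λ k → *-zeroʳ (f (suc k)))) ⟩
  f zero * (+ 1 - + 0) + + 0
    ≡⟨ solve 1 (λ a → a :* (con (+ 1) :- con (+ 0)) :+ con (+ 0) := a) refl (f zero) ⟩
  f zero ∎

Δ-suc : ∀ {n} (f : Fin (suc n) → ℤ) y → Δ f (suc y) ≡ Δ (f ∘ suc) y - f zero * δ₁ zero y
Δ-suc f y = solve 3 (λ a d s → a :* (con (+ 0) :- d) :+ s := s :- a :* d) refl
  (f zero) (δ₁ zero y) (Δ (f ∘ suc) y)

Δ-const-zero : ∀ {n} y → Δ {n} (λ _ → + 0) y ≡ + 0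
Δ-const-zero {n} y = sumℤ-zero n (λ _ → refl)

Δ-*ˡ : ∀ {n} c (f : Fin n → ℤ) y → Δ (λ a → c * f a) y ≡ c * Δ f y
Δ-*ˡ {n} c f y = begin
  sumℤ n (λ k → c * f k * step k y)   ≡⟨ sumℤ-cong n (λ k → *-assoc c (f k) (step k y)) ⟩
  sumℤ n (λ k → c * (f k * step k y)) ≡⟨ sumℤ-*ˡ n c (λ k → f k * step k y) ⟩
  c * Δ f y                            ∎

Δ-*ʳ : ∀ {n} (f : Fin n → ℤ) c y → Δ (λ a → f a * c) y ≡ Δ f y * c
Δ-*ʳ f c y = begin
  Δ (λ a → f a * c) y ≡⟨ Δ-cong (λ a → *-comm (f a) c) y ⟩
  Δ (λ a → c * f a) y ≡⟨ Δ-*ˡ c f y ⟩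
  c * Δ f y           ≡⟨ *-comm c (Δ f y) ⟩
  Δ f y * c           ∎

Δ-injective : ∀ {n} {f g : Fin n → ℤ} → (∀ y → Δ f y ≡ Δ g y) → ∀ i → f i ≡ g i
Δ-injective {suc n} {f} {g} Δf≡Δg zero = begin
  f zero        ≡⟨ Δ-zero f ⟨
  Δ f zero      ≡⟨ Δf≡Δg zero ⟩
  Δ g zero      ≡⟨ Δ-zero g ⟩
  g zero        ∎
Δ-injective {suc n} {f} {g} Δf≡Δg (suc i) = Δ-injective {f = f ∘ suc} {g ∘ suc} Δtail i
  where
  head : f zero ≡ g zero
  head = Δ-injective {f = f} {g} Δf≡Δg zero
  Δtail : ∀ y → Δ (f ∘ suc) y ≡ Δ (g ∘ suc) y
  Δtail y = ∙-cancelʳ (- (f zero * δ₁ zero y)) _ _ (begin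
    Δ (f ∘ suc) y - f zero * δ₁ zero y ≡⟨ Δ-suc f y ⟨
    Δ f (suc y)                        ≡⟨ Δf≡Δg (suc y) ⟩
    Δ g (suc y)                        ≡⟨ Δ-suc g y ⟩
    Δ (g ∘ suc) y - g zero * δ₁ zero y ≡⟨ cong (λ c → Δ (g ∘ suc) y - c * δ₁ zero y) head ⟨
    Δ (g ∘ suc) y - f zero * δ₁ zero y ∎)

-- Indicator of the half-open interval [i, j).
interval : ∀ {n} → Fin (suc n) → Fin (suc n) → Fin n → ℕ
interval zero    (suc j) zero    = 1
interval zero    (suc j) (suc a) = interval zero j a
interval (suc i) (suc j) (suc a) = interval i j a
interval _       _       _       = 0

Δ-interval : ∀ {n} (i j : Fin (suc n)) → i F.≤ j → ∀ y →
  Δ (λ a → + interval i j a) y ≡ δ₁ i y - δ₁ j y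
Δ-interval zero zero _ y = trans (Δ-const-zero y) (sym (+-inverseʳ (δ₁ zero y)))
Δ-interval {suc n} zero (suc j) _ zero = Δ-zero (λ a → + interval zero (suc j) a)
Δ-interval {suc n} zero (suc j) _ (suc y) = begin
  Δ (λ a → + interval zero (suc j) a) (suc y)
    ≡⟨ Δ-suc (λ a → + interval zero (suc j) a) y ⟩
  Δ (λ a → + interval zero j a) y - + 1 * δ₁ zero y
    ≡⟨ cong (_- + 1 * δ₁ zero y) (Δ-interval zero j z≤n y) ⟩
  δ₁ zero y - δ₁ j y - + 1 * δ₁ zero y
    ≡⟨ solve 2 (λ a b → a :- b :- con (+ 1) :* a := con (+ 0) :- b) refl (δ₁ zero y) (δ₁ j y) ⟩
  + 0 - δ₁ j y ∎
Δ-interval {suc n} (suc i) (suc j) _  zero = Δ-zero (λ a → + interval (suc i) (suc j) a)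
Δ-interval {suc n} (suc i) (suc j) i≤j (suc y) = begin
  Δ (λ a → + interval (suc i) (suc j) a) (suc y) ≡⟨ Δ-suc (λ a → + interval (suc i) (suc j) a) y ⟩
  Δ (λ a → + interval i j a) y - + 0             ≡⟨ +-identityʳ _ ⟩
  Δ (λ a → + interval i j a) y                   ≡⟨ Δ-interval i j (s≤s⁻¹ i≤j) y ⟩
  δ₁ i y - δ₁ j y                                ∎

combo-Δ : ∀ {p q} (T : Fin p → Fin q → ℕ) x y → combo T x y ≡ Δ (λ i → Δ (λ k → + T i k) y) x
combo-Δ {p} {q} T x y = sumℤ-cong p row
  where
  C : Fin p → Fin q → ℤ
  C i k = switchMat (inject₁ i) (suc i) (inject₁ k) (suc k) x y
  row : ∀ i → sumℤ q (λ k → + T i k * C i k) ≡ Δ (λ k → + T i k) y * step i x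
  row i = begin
    sumℤ q (λ k → + T i k * C i k)
      ≡⟨ sumℤ-cong q (λ k → cong (+ T i k *_)
           (switchMat-factor (inject₁ i) (suc i) x (inject₁ k) (suc k) y)) ⟩
    sumℤ q (λ k → + T i k * (step i x * step k y))
      ≡⟨ sumℤ-cong q (λ k → solve 3 (λ t a b → t :* (a :* b) := a :* (t :* b))
           refl (+ T i k) (step i x) (step k y)) ⟩
    sumℤ q (λ k → step i x * (+ T i k * step k y))
      ≡⟨ sumℤ-*ˡ q (step i x) (λ k → + T i k * step k y) ⟩
    step i x * Δ (λ k → + T i k) y
      ≡⟨ *-comm (step i x) _ ⟩
    Δ (λ k → + T i k) y * step i x ∎

combo-injective : ∀ {p q} {T₁ T₂ : Fin p → Fin q → ℕ} →
  (∀ x y → combo T₁ x y ≡ combo T₂ x y) → ∀ i k → T₁ i k ≡ T₂ i k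
combo-injective {p} {q} {T₁} {T₂} combo≡ i k =
  +-injective (Δ-injective {f = row T₁ i} {row T₂ i} (rowΔ i) k)
  where
  row : (Fin p → Fin q → ℕ) → Fin p → Fin q → ℤ
  row T i k = + T i k
  ΔΔ : ∀ y x → Δ (λ i → Δ (row T₁ i) y) x ≡ Δ (λ i → Δ (row T₂ i) y) x
  ΔΔ y x = trans (sym (combo-Δ T₁ x y)) (trans (combo≡ x y) (combo-Δ T₂ x y))
  rowΔ : ∀ i y → Δ (row T₁ i) y ≡ Δ (row T₂ i) y
  rowΔ i y = Δ-injective {f = λ i → Δ (row T₁ i) y} {λ i → Δ (row T₂ i) y} (ΔΔ y) i

combo-zero : ∀ {p q} x y → combo {p} {q} (λ _ _ → 0) x y ≡ + 0
combo-zero {p} {q} x y = sumℤ-zero p (λ _ → sumℤ-zero q (λ _ → refl))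

combo-+ : ∀ {p q} (T₁ T₂ : Fin p → Fin q → ℕ) x y →
  combo (λ a b → T₁ a b ℕ.+ T₂ a b) x y ≡ combo T₁ x y + combo T₂ x y
combo-+ {p} {q} T₁ T₂ x y =
  trans (sumℤ-cong p (λ a →
          trans (sumℤ-cong q (λ b →
                   trans (cong (_* C a b) (pos-+ (T₁ a b) (T₂ a b)))
                         (*-distribʳ-+ (C a b) (+ T₁ a b) (+ T₂ a b))))
                (sumℤ-+ q _ _)))
        (sumℤ-+ p _ _)
  where
  C : Fin p → Fin q → ℤ
  C a b = switchMat (inject₁ a) (suc a) (inject₁ b) (suc b) x y

rectangle : ∀ {p q} → Fin (suc p) → Fin (suc p) → Fin (suc q) → Fin (suc q) →
  Fin p → Fin q → ℕ
rectangle i j k l a b = interval i j a ℕ.* interval k l b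

combo-rectangle : ∀ {p q} (i j : Fin (suc p)) (k l : Fin (suc q)) → i F.≤ j → k F.≤ l →
  ∀ x y → combo (rectangle i j k l) x y ≡ switchMat i j k l x y
combo-rectangle {p} {q} i j k l i≤j k≤l x y = begin
  combo (rectangle i j k l) x y
    ≡⟨ combo-Δ (rectangle i j k l) x y ⟩
  Δ (λ a → Δ (λ b → + (I a ℕ.* K b)) y) x
    ≡⟨ Δ-cong (λ a → trans (Δ-cong (λ b → pos-* (I a) (K b)) y)
                           (Δ-*ˡ (+ I a) (λ b → + K b) y)) x ⟩
  Δ (λ a → + I a * Δ (λ b → + K b) y) x
    ≡⟨ Δ-*ʳ (λ a → + I a) (Δ (λ b → + K b) y) x ⟩
  Δ (λ a → + I a) x * Δ (λ b → + K b) y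
    ≡⟨ cong₂ _*_ (Δ-interval i j i≤j x) (Δ-interval k l k≤l y) ⟩
  (δ₁ i x - δ₁ j x) * (δ₁ k y - δ₁ l y)
    ≡⟨ switchMat-factor i j x k l y ⟨
  switchMat i j k l x y ∎
  where
  I : Fin p → ℕ
  I = interval i j
  K : Fin q → ℕ
  K = interval k l

diffMat-switch : ∀ {p q} {A B : BinMat p q} {i j : Fin p} {k l : Fin q} →
  i F.< j → k F.< l →
  A i k ≡ false → A i l ≡ true → A j k ≡ true → A j l ≡ false →
  B i k ≡ true → B i l ≡ false → B j k ≡ false → B j l ≡ true →
  (∀ x y → ¬ ((x ≡ i ⊎ x ≡ j) × (y ≡ k ⊎ y ≡ l)) → B x y ≡ A x y) →
  ∀ x y → diffMat B A x y ≡ switchMat i j k l x y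
diffMat-switch {A = A} {B} {i} {j} {k} {l} i<j k<l a₁ a₂ a₃ a₄ b₁ b₂ b₃ b₄ elsewhere x y =
  trans (entry x y (x ≟ i) (x ≟ j) (y ≟ k) (y ≟ l)) (sym (switchMat-factor i j x k l y))
  where
  i≢j : ¬ i ≡ j
  i≢j = <⇒≢ i<j
  k≢l : ¬ k ≡ l
  k≢l = <⇒≢ k<l
  l≢k : ¬ l ≡ k
  l≢k l≡k = k≢l (sym l≡k)
  unchanged : ∀ x y → ¬ ((x ≡ i ⊎ x ≡ j) × (y ≡ k ⊎ y ≡ l)) → diffMat B A x y ≡ + 0
  unchanged x y outside =
    trans (cong (λ b → bℤ b - bℤ (A x y)) (elsewhere x y outside)) (+-inverseʳ (bℤ (A x y)))
  offColumns : ∀ {x y} → ¬ y ≡ k → ¬ y ≡ l → ¬ ((x ≡ i ⊎ x ≡ j) × (y ≡ k ⊎ y ≡ l))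
  offColumns y≢k y≢l (_ , inj₁ y≡k) = y≢k y≡k
  offColumns y≢k y≢l (_ , inj₂ y≡l) = y≢l y≡l
  offRows : ∀ {x y} → ¬ x ≡ i → ¬ x ≡ j → ¬ ((x ≡ i ⊎ x ≡ j) × (y ≡ k ⊎ y ≡ l))
  offRows x≢i x≢j (inj₁ x≡i , _) = x≢i x≡i
  offRows x≢i x≢j (inj₂ x≡j , _) = x≢j x≡j
  entry : ∀ x y → Dec (x ≡ i) → Dec (x ≡ j) → Dec (y ≡ k) → Dec (y ≡ l) →
    diffMat B A x y ≡ (δ₁ i x - δ₁ j x) * (δ₁ k y - δ₁ l y)
  entry x y (yes refl) _ (yes refl) _
    rewrite a₁ | b₁ | δ₁-refl i | δ₁-≢ i≢j | δ₁-refl k | δ₁-≢ k≢l = refl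
  entry x y (yes refl) _ (no _) (yes refl)
    rewrite a₂ | b₂ | δ₁-refl i | δ₁-≢ i≢j | δ₁-refl l | δ₁-≢ l≢k = refl
  entry x y (yes refl) _ (no y≢k) (no y≢l)
    rewrite δ₁-≢ y≢k | δ₁-≢ y≢l
    = trans (unchanged i y (offColumns y≢k y≢l)) (sym (*-zeroʳ (δ₁ i x - δ₁ j x)))
  entry x y (no x≢i) (yes refl) (yes refl) _
    rewrite a₃ | b₃ | δ₁-refl j | δ₁-≢ x≢i | δ₁-refl k | δ₁-≢ k≢l = refl
  entry x y (no x≢i) (yes refl) (no _) (yes refl)
    rewrite a₄ | b₄ | δ₁-refl j | δ₁-≢ x≢i | δ₁-refl l | δ₁-≢ l≢k = refl
  entry x y (no _) (yes refl) (no y≢k) (no y≢l)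
    rewrite δ₁-≢ y≢k | δ₁-≢ y≢l
    = trans (unchanged j y (offColumns y≢k y≢l)) (sym (*-zeroʳ (δ₁ i x - δ₁ j x)))
  entry x y (no x≢i) (no x≢j) _ _
    rewrite δ₁-≢ x≢i | δ₁-≢ x≢j
    = unchanged x y (offRows x≢i x≢j)

positiveSwitch⇒combo : ∀ {p q} {A B : BinMat (suc p) (suc q)} → PositiveSwitch A B →
  Σ (Fin p → Fin q → ℕ) λ T → ∀ x y → diffMat B A x y ≡ combo T x y
positiveSwitch⇒combo
  (i , j , k , l , i<j , k<l , a₁ , a₂ , a₃ , a₄ , b₁ , b₂ , b₃ , b₄ , elsewhere) =
  rectangle i j k l , λ x y →
    trans (diffMat-switch i<j k<l a₁ a₂ a₃ a₄ b₁ b₂ b₃ b₄ elsewhere x y)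
          (sym (combo-rectangle i j k l (<⇒≤ i<j) (<⇒≤ k<l) x y))

diffMat-split : ∀ {p q} (A B C : BinMat p q) x y →
  diffMat C A x y ≡ diffMat C B x y + diffMat B A x y
diffMat-split A B C x y = solve 3 (λ a b c → c :- a := (c :- b) :+ (b :- a))
  refl (bℤ (A x y)) (bℤ (B x y)) (bℤ (C x y))

reachable⇒combo : ∀ {p q} {A A′ : BinMat (suc p) (suc q)} → Reachable A A′ →
  Σ (Fin p → Fin q → ℕ) λ T → ∀ x y → diffMat A′ A x y ≡ combo T x y
reachable⇒combo {A = A} ε = (λ _ _ → 0) , λ x y →
  trans (+-inverseʳ (bℤ (A x y))) (sym (combo-zero x y))
reachable⇒combo {A = A} {A′} (_◅_ {j = B} switch rest)
  with reachable⇒combo rest | positiveSwitch⇒combo switch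
... | T′ , M′≡T′ | T , M≡T = (λ a b → T′ a b ℕ.+ T a b) , λ x y → begin
  diffMat A′ A x y                   ≡⟨ diffMat-split A B A′ x y ⟩
  diffMat A′ B x y + diffMat B A x y ≡⟨ cong₂ _+_ (M′≡T′ x y) (M≡T x y) ⟩
  combo T′ x y + combo T x y         ≡⟨ combo-+ T′ T x y ⟨
  combo (λ a b → T′ a b ℕ.+ T a b) x y ∎

proposition3 : (p q : ℕ) (R : Fin (suc p) → ℕ) (C : Fin (suc q) → ℕ)
    (A A′ : BinMat (suc p) (suc q)) →
    InM R C A → InM R C A′ → Reachable A A′ →
    Σ (Fin p → Fin q → ℕ) (λ T → ∀ x y → diffMat A′ A x y ≡ combo T x y) ×
    (∀ (T₁ T₂ : Fin p → Fin q → ℕ) →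
      (∀ x y → diffMat A′ A x y ≡ combo T₁ x y) →
      (∀ x y → diffMat A′ A x y ≡ combo T₂ x y) →
      ∀ i k → T₁ i k ≡ T₂ i k)
proposition3 p q R C A A′ _ _ reach =
  reachable⇒combo reach ,
  λ T₁ T₂ M≡T₁ M≡T₂ → combo-injective (λ x y → trans (sym (M≡T₁ x y)) (M≡T₂ x y))
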